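{- Let $k \ge 1$ and $a_1, \dots, a_k, c \in \mathbb{Z}$. The threshold protocol $\mathcal{P}_{\mathrm{thr}}$ for $\sum_{i=1}^k a_i x_i < c$ (defined in the context) satisfies strong consensus.
   Context: Threshold protocol: let $v_{\max} = \max(|a_1|, \dots, |a_k|, |c|+1)$, $f(m,n) = \max(-v_{\max}, \min(v_{\max}, m+n))$, $g(m,n) = (m+n) - f(m,n)$, and $b(m,n) = 1$ if $f(m,n) < c$ and $0$ otherwise. $\mathcal{P}_{\mathrm{thr}} = (Q,T,\Sigma,I,O)$ with $Q = \{0,1\} \times \{ -v_{\max},\dots,v_{\max}\} \times \{0,1\}$, $\Sigma = \{x_1,\dots,x_k\}$, $I(x_i) = (1, a_i, [a_i < c])$ where $[a_i<c] \in \{0,1\}$ is the truth value, $O(\ell, n, o) = o$, and $T$ contains, for all $n, n' \in \{ -v_{\max},\dots,v_{\max}\}$ and $\ell, o, o' \in \{0,1\}$, the transition $(1,n,o),(\ell,n',o') \mapsto (1, f(n,n'), b(n,n')), (0, g(n,n'), b(n,n'))$, together with silent transitions $(p,q)\mapsto(p,q)$ for pairs of states $p,q$ both having first component $0$. General definitions: a population over a finite set $E$ is a map $M : E \to \mathbb{N}$ with $\sum_e M(e) \ge 2$. A population protocol is $(Q, T, \Sigma, I, O)$ with $T \subseteq Q^2 \times Q^2$ containing for each $(p,q)$ some $(p,q,p',q')$, $I : \Sigma \to Q$, $O : Q \to \{0,1\}$. Configurations are populations over $Q$. For $t = (p,q,p',q')$, written $(p,q)\mapsto(p',q')$, $\mathrm{pre}(t)$,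 $\mathrm{post}(t)$ are the multisets $\{p,q\}$, $\{p',q'\}$; $t$ is enabled at $C$ if $C \ge \mathrm{pre}(t)$, leading to $C - \mathrm{pre}(t) + \mathrm{post}(t)$; $t$ is silent if $\mathrm{pre}(t) = \mathrm{post}(t)$. $C$ is terminal if every configuration reachable from $C$ equals $C$; $C$ is a consensus configuration if all states in $\mathrm{supp}(C)$ have the same output $O(C)$. For an input $X$ (population over $\Sigma$), $I(X)(q) = \sum_{\sigma : I(\sigma)=q} X(\sigma)$; such configurations are initial. Flow equations for $C, C', x : T \to \mathbb{N}$: $C'(q) = C(q) + \sum_t x(t)(\mathrm{post}(t)(q) - \mathrm{pre}(t)(q))$ for all $q$. For $R \subseteq Q$: ${}^\bullet R = \{t : \mathrm{supp}(\mathrm{post}(t)) \cap R \ne \emptyset\}$, $R^\bullet = \{t : \mathrm{supp}(\mathrm{pre}(t)) \cap R \ne \emptyset\}$, $C(R) = \sum_{q\in R} C(q)$. For $U \subseteq T$, $P$ is a $U$-trap if $P^\bullet \cap U \subseteq {}^\bullet P$, a $U$-siphon if ${}^\bullet P \cap U \subseteq P^\bullet$. $C'$ is potentially reachable from $C$ if for some $x : T \to \mathbb{N}$, with $U = \mathrm{supp}(x)$, the flow equations hold, $C'(P)=0 \Rightarrow {}^\bullet P \cap U = \emptyset$ for every $U$-trap $P$, and $C(P) = 0 \Rightarrow P^\bullet \cap U = \emptyset$ for every $U$-siphon $P$. A protocol satisfies strong consensus if for every initial $C$ there is $b$ such that every terminal configuration $C'$ potentially reachable from $C$ is a consensus configuration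 with $O(C') = b$. -}

module Defs where

open import Data.Bool using (Bool; true; false; if_then_else_; _∧_)
open import Data.Bool.Properties using () renaming (_≟_ to _≟B_)
open import Data.Nat as ℕ using (ℕ; zero; suc; _≤_; _⊔_; _⊓_; s≤s)
open import Data.Nat.Properties using (m⊓n≤n)
open import Data.Integer as ℤ using (ℤ; +_; ∣_∣; _-_)
import Data.Integer.Properties as ℤP
open import Data.Fin using (Fin; toℕ; fromℕ<)
open import Data.Fin.Properties using () renaming (_≟_ to _≟F_)
open import Data.Nat.ListAction using (sum)
open import Data.List using (List; []; _∷_; map; allFin; cartesianProduct; foldr)
open import Data.List.Membership.Propositional using (_∈_)
open import Data.List.Membership.Propositional.Properties using (∈-allFin; ∈-cartesianProduct⁺)
open import Data.List.Relation.Unary.Unique.Propositional using (Unique)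
open import Data.List.Relation.Unary.Unique.Propositional.Properties using (allFin⁺; cartesianProduct⁺)
open import Data.List.Relation.Unary.AllPairs using ([]; _∷_)
open import Data.List.Relation.Unary.All using ([]; _∷_)
open import Data.List.Relation.Unary.Any using (here; there)
open import Data.Product using (Σ; ∃; ∃-syntax; _×_; _,_)
open import Data.Product.Properties using (≡-dec)
open import Data.Sum using (_⊎_)
open import Relation.Nullary using (¬_)
open import Relation.Nullary.Decidable using (⌊_⌋)
open import Relation.Binary.Definitions using (DecidableEquality)
open import Relation.Binary.PropositionalEquality using (_≡_; _≢_; refl)
open import Relation.Binary.Construct.Closure.ReflexiveTransitive using (Star)

-- A population protocol with a finite state type Q (given by a complete,
-- duplicate-free enumeration Qs), input alphabet Fin nΣ, transition
-- relation T ⊆ Q² × Q² (as a predicate on (p , q , p' , q')), input map I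
-- and output map O (outputs 0/1 encoded as false/true).
record Protocol : Set₁ where
  field
    Q           : Set
    _≟Q_        : DecidableEquality Q
    Qs          : List Q
    Qs-complete : ∀ q → q ∈ Qs
    Qs-unique   : Unique Qs
    nΣ          : ℕ
    T           : Q × Q × Q × Q → Set
    I           : Fin nΣ → Q
    O           : Q → Bool

module Semantics (𝒫 : Protocol) where
  open Protocol 𝒫

  Tr : Set
  Tr = Q × Q × Q × Q

  sumQ : (Q → ℕ) → ℕ
  sumQ f = sum (map f Qs)

  sumTr : (Tr → ℕ) → ℕ
  sumTr f = sumQ λ p → sumQ λ q → sumQ λ p' → sumQ λ q' → f (p , q , p' , q')

  Config : Set
  Config = Q → ℕ

  IsPopulation : Config → Set
  IsPopulation C = 2 ≤ sumQ C

  ind : Q → Q → ℕ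
  ind p r = if ⌊ p ≟Q r ⌋ then 1 else 0

  pre post : Tr → Q → ℕ
  pre  (p , q , p' , q') r = ind p r ℕ.+ ind q r
  post (p , q , p' , q') r = ind p' r ℕ.+ ind q' r

  Step : Config → Config → Set
  Step C C' = ∃[ t ] (T t × (∀ r → pre t r ≤ C r)
                          × (∀ r → C' r ℕ.+ pre t r ≡ C r ℕ.+ post t r))

  Reachable : Config → Config → Set
  Reachable = Star Step

  Terminal : Config → Set
  Terminal C = ∀ C' → Reachable C C' → ∀ r → C' r ≡ C r

  ConsensusWith : Config → Bool → Set
  ConsensusWith C b = ∀ r → C r ≢ 0 → O r ≡ b

  Subset : Set
  Subset = Q → Bool

  mass : Config → Subset → ℕ
  mass C R = sumQ λ r → if R r then C r else 0

  •_ : Subset → Tr → Set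
  (• R) (p , q , p' , q') = R p' ≡ true ⊎ R q' ≡ true

  _• : Subset → Tr → Set
  (R •) (p , q , p' , q') = R p ≡ true ⊎ R q ≡ true

  InSupp : (Tr → ℕ) → Tr → Set
  InSupp x t = x t ≢ 0

  IsTrap : (Tr → ℕ) → Subset → Set
  IsTrap x P = ∀ t → InSupp x t → (P •) t → (• P) t

  IsSiphon : (Tr → ℕ) → Subset → Set
  IsSiphon x P = ∀ t → InSupp x t → (• P) t → (P •) t

  -- flow equations (with the negative terms moved to the left, over ℕ)
  Flow : Config → Config → (Tr → ℕ) → Set
  Flow C C' x = ∀ r → C' r ℕ.+ sumTr (λ t → x t ℕ.* pre t r)
                      ≡ C r ℕ.+ sumTr (λ t → x t ℕ.* post t r)

  PotentiallyReachable : Config → Config → Set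
  PotentiallyReachable C C' =
    Σ (Tr → ℕ) λ x →
        (∀ t → InSupp x t → T t)            -- x : T → ℕ
      × Flow C C' x
      × (∀ P → IsTrap x P → mass C' P ≡ 0 → ∀ t → InSupp x t → ¬ (• P) t)
      × (∀ P → IsSiphon x P → mass C P ≡ 0 → ∀ t → InSupp x t → ¬ (P •) t)

  InputPopulation : (Fin nΣ → ℕ) → Set
  InputPopulation X = 2 ≤ sum (map X (allFin nΣ))

  initial : (Fin nΣ → ℕ) → Config
  initial X r = sum (map (λ σ → if ⌊ I σ ≟Q r ⌋ then X σ else 0) (allFin nΣ))

  StrongConsensus : Set
  StrongConsensus =
    ∀ X → InputPopulation X →
      ∃[ b ] (∀ C' → IsPopulation C' → PotentiallyReachable (initial X) C'
                   → Terminal C' → ConsensusWith C' b)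

module Threshold (k : ℕ) (a : Fin k → ℤ) (c : ℤ) where

  vmax : ℕ
  vmax = foldr _⊔_ (suc ∣ c ∣) (map (λ i → ∣ a i ∣) (allFin k))

  -- the value component {-vmax, …, vmax} is encoded by Fin (2·vmax + 1),
  -- index i standing for the integer  i - vmax
  Val : Set
  Val = Fin (suc (vmax ℕ.+ vmax))

  val : Val → ℤ
  val i = + toℕ i - + vmax

  -- inverse of val on {-vmax, …, vmax} (only used on a_i, |a_i| ≤ vmax)
  enc : ℤ → Val
  enc z = fromℕ< {∣ z ℤ.+ + vmax ∣ ⊓ (vmax ℕ.+ vmax)}
                 (s≤s (m⊓n≤n ∣ z ℤ.+ + vmax ∣ (vmax ℕ.+ vmax)))

  f g : ℤ → ℤ → ℤ
  f m n = (ℤ.- + vmax) ℤ.⊔ (+ vmax ℤ.⊓ (m ℤ.+ n))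
  g m n = (m ℤ.+ n) - f m n

  bb : ℤ → ℤ → Bool
  bb m n = ⌊ f m n ℤ.<? c ⌋

  State : Set
  State = Bool × Val × Bool

  States : List State
  States = cartesianProduct (false ∷ true ∷ [])
             (cartesianProduct (allFin _) (false ∷ true ∷ []))

  private
    boolUnique : Unique (false ∷ true ∷ [])
    boolUnique = ((λ ()) ∷ []) ∷ [] ∷ []

    bool∈ : ∀ x → x ∈ (false ∷ true ∷ [])
    bool∈ false = here refl
    bool∈ true  = there (here refl)

  Trans : State × State × State × State → Set
  Trans ((ℓ₁ , n₁ , o₁) , (ℓ₂ , n₂ , o₂) , (ℓ₃ , n₃ , o₃) , (ℓ₄ , n₄ , o₄)) =
      (ℓ₁ ≡ true
       × ℓ₃ ≡ true  × val n₃ ≡ f (val n₁) (val n₂) × o₃ ≡ bb (val n₁) (val n₂)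
       × ℓ₄ ≡ false × val n₄ ≡ g (val n₁) (val n₂) × o₄ ≡ bb (val n₁) (val n₂))
    ⊎ (ℓ₁ ≡ false × ℓ₂ ≡ false
       × (ℓ₃ , n₃ , o₃) ≡ (ℓ₁ , n₁ , o₁) × (ℓ₄ , n₄ , o₄) ≡ (ℓ₂ , n₂ , o₂))

  Pthr : Protocol
  Pthr = record
    { Q           = State
    ; _≟Q_        = ≡-dec _≟B_ (≡-dec _≟F_ _≟B_)
    ; Qs          = States
    ; Qs-complete = λ { (ℓ , n , o) →
                        ∈-cartesianProduct⁺ (bool∈ ℓ)
                          (∈-cartesianProduct⁺ (∈-allFin n) (bool∈ o)) }
    ; Qs-unique   = cartesianProduct⁺ boolUnique
                      (cartesianProduct⁺ (allFin⁺ _) boolUnique)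
    ; nΣ          = k
    ; T           = Trans
    ; I           = λ i → (true , enc (a i) , ⌊ a i ℤ.<? c ⌋)
    ; O           = λ { (ℓ , n , o) → o }
    }

-- Transitions consuming an active agent (first component 1) produce one, and all others
-- are silent, so the active states form a trap; since initial configurations consist of
-- active agents only, the trap condition leaves an active agent in every potentially
-- reachable population. In a terminal configuration every interaction of that agent is
-- silent: it is the only active agent, its value m is a fixed point of the clamped sum
-- m + m' for the value m' of every other agent, and every agent outputs [m < c]. As
-- |c| < vmax, the fixed-point property makes all other values ≤ 0 when m < c and ≥ 0
-- when m ≥ c, so the total value, which the flow equations preserve and which therefore
-- equals its initial value, lies on the same side of c as m.

module Submission where

module IntegerFacts where

  open import Data.Nat as ℕ using (ℕ; z≤n; s≤s)
  open import Data.Integer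
  open import Data.Integer.Properties
  open import Data.Integer.Tactic.RingSolver using (solve; solve-∀)
  open import Data.List using ([]; _∷_)
  open import Data.Product using (_×_; _,_)
  open import Data.Sum using (inj₁; inj₂)
  open import Relation.Nullary using (contradiction)
  open import Relation.Binary.PropositionalEquality

  ∣i∣<n⇒i<n : ∀ i {n} → ∣ i ∣ ℕ.< n → i < + n
  ∣i∣<n⇒i<n (+ _)    ∣i∣<n = +<+ ∣i∣<n
  ∣i∣<n⇒i<n -[1+ _ ] _     = -<+

  ∣i∣<n⇒-n<i : ∀ i {n} → ∣ i ∣ ℕ.< n → - + n < i
  ∣i∣<n⇒-n<i (+ _)    (s≤s _)     = -<+
  ∣i∣<n⇒-n<i -[1+ _ ] (s≤s ∣i∣<n) = -<- ∣i∣<n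

  i+j≤i⇒j≤0 : ∀ {i j} → i + j ≤ i → j ≤ 0ℤ
  i+j≤i⇒j≤0 {i} {j} i+j≤i = begin
    j             ≡⟨ solve (i ∷ j ∷ []) ⟩
    - i + (i + j) ≤⟨ +-monoʳ-≤ (- i) i+j≤i ⟩
    - i + i       ≡⟨ +-inverseˡ i ⟩
    0ℤ            ∎
    where open ≤-Reasoning

  i≤i+j⇒0≤j : ∀ {i j} → i ≤ i + j → 0ℤ ≤ j
  i≤i+j⇒0≤j {i} {j} i≤i+j = begin
    0ℤ            ≡⟨ +-inverseˡ i ⟨
    - i + i       ≤⟨ +-monoʳ-≤ (- i) i≤i+j ⟩
    - i + (i + j) ≡⟨ solve (i ∷ j ∷ []) ⟩
    j             ∎
    where open ≤-Reasoning

  m+n≤o+p⇒m-p≤o-n : ∀ m n o p → m ℕ.+ n ℕ.≤ o ℕ.+ p → + m - + p ≤ + o - + n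
  m+n≤o+p⇒m-p≤o-n m n o p le = begin
    + m - + p                 ≡⟨ shiftˡ (+ m) (+ n) (+ p) ⟨
    (+ m + + n) - (+ n + + p) ≤⟨ +-monoˡ-≤ (- (+ n + + p)) (+≤+ le) ⟩
    (+ o + + p) - (+ n + + p) ≡⟨ shiftʳ (+ o) (+ n) (+ p) ⟩
    + o - + n                 ∎
    where
    open ≤-Reasoning
    shiftˡ : ∀ x y z → (x + y) - (y + z) ≡ x - z
    shiftˡ = solve-∀
    shiftʳ : ∀ x y z → (x + z) - (y + z) ≡ x - y
    shiftʳ = solve-∀

  module Clamp (v : ℕ) where

    V : ℤ
    V = + v

    clamp : ℤ → ℤ
    clamp z = - V ⊔ (V ⊓ z)

    -V≤V : - V ≤ V
    -V≤V = ≤-trans (neg-mono-≤ (+≤+ z≤n)) (+≤+ z≤n)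

    -V≤clamp : ∀ z → - V ≤ clamp z
    -V≤clamp z = i≤i⊔j (- V) (V ⊓ z)

    clamp≤V : ∀ z → clamp z ≤ V
    clamp≤V z = ⊔-lub -V≤V (i⊓j≤i V z)

    clamp<V⇒≤clamp : ∀ z → clamp z < V → z ≤ clamp z
    clamp<V⇒≤clamp z clamp<V with ⊓-sel V z
    ... | inj₁ V⊓z≡V = contradiction (subst (_≤ clamp z) V⊓z≡V (i≤j⊔i (- V) (V ⊓ z))) (<⇒≱ clamp<V)
    ... | inj₂ V⊓z≡z = subst (_≤ clamp z) V⊓z≡z (i≤j⊔i (- V) (V ⊓ z))

    -V<clamp⇒clamp≤ : ∀ z → - V < clamp z → clamp z ≤ z
    -V<clamp⇒clamp≤ z -V<clamp with ⊔-sel (- V) (V ⊓ z)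
    ... | inj₁ clamp≡-V = contradiction -V<clamp (<-irrefl (sym clamp≡-V))
    ... | inj₂ clamp≡V⊓z = subst (_≤ z) (sym clamp≡V⊓z) (i⊓j≤j V z)

    clamp+excess : ∀ z → clamp z + (z - clamp z) ≡ z
    clamp+excess z = y+[x-y]≡x z (clamp z)
      where
      y+[x-y]≡x : ∀ x y → y + (x - y) ≡ x
      y+[x-y]≡x = solve-∀

    excess-bounds : ∀ z → - V + - V ≤ z → z ≤ V + V → - V ≤ z - clamp z × z - clamp z ≤ V
    excess-bounds z lower upper = lower-bound , upper-bound
      where
      open ≤-Reasoning
      clamp≤z+V : clamp z ≤ z + V
      clamp≤z+V = ⊔-lub -V≤z+V (≤-trans (i⊓j≤j V z) (i≤i+j z V))
        where
        -V≤z+V : - V ≤ z + V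
        -V≤z+V = begin
          - V           ≡⟨ cancel (- V) V ⟨
          - V + - V + V ≤⟨ +-monoˡ-≤ V lower ⟩
          z + V         ∎
          where
          cancel : ∀ x y → x + - y + y ≡ x
          cancel = solve-∀
      z-V≤clamp : z - V ≤ clamp z
      z-V≤clamp = ≤-trans (⊓-glb z-V≤V (i-j≤i z V)) (i≤j⊔i (- V) (V ⊓ z))
        where
        z-V≤V : z - V ≤ V
        z-V≤V = begin
          z - V     ≤⟨ +-monoˡ-≤ (- V) upper ⟩
          V + V - V ≡⟨ cancel V V ⟩
          V         ∎
          where
          cancel : ∀ x y → x + y - y ≡ x
          cancel = solve-∀
      lower-bound : - V ≤ z - clamp z
      lower-bound = begin
        - V           ≡⟨ cancel z V ⟨
        z - (z + V)   ≤⟨ +-monoʳ-≤ z (neg-mono-≤ clamp≤z+V) ⟩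
        z - clamp z   ∎
        where
        cancel : ∀ x y → x - (x + y) ≡ - y
        cancel = solve-∀
      upper-bound : z - clamp z ≤ V
      upper-bound = begin
        z - clamp z   ≤⟨ +-monoʳ-≤ z (neg-mono-≤ z-V≤clamp) ⟩
        z - (z - V)   ≡⟨ cancel z V ⟩
        V             ∎
        where
        cancel : ∀ x y → x - (x - y) ≡ y
        cancel = solve-∀

    clamp-fixed⇒≤0 : ∀ m j → clamp (m + j) ≡ m → m < V → j ≤ 0ℤ
    clamp-fixed⇒≤0 m j fixed m<V =
      i+j≤i⇒j≤0 (subst (m + j ≤_) fixed (clamp<V⇒≤clamp (m + j) (subst (_< V) (sym fixed) m<V)))

    clamp-fixed⇒≥0 : ∀ m j → clamp (m + j) ≡ m → - V < m → 0ℤ ≤ j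
    clamp-fixed⇒≥0 m j fixed -V<m =
      i≤i+j⇒0≤j (subst (_≤ m + j) fixed (-V<clamp⇒clamp≤ (m + j) (subst (- V <_) (sym fixed) -V<m)))

open import Defs
open import Data.Fin using (Fin; toℕ)
open import Data.Fin.Properties using (toℕ-fromℕ<; toℕ≤pred[n])
open import Data.Integer as ℤ using (ℤ; ∣_∣)
import Data.Integer.Properties as ℤP
open import Data.Integer.Tactic.RingSolver using (solve-∀)
open IntegerFacts
open import Algebra.Properties.CommutativeSemigroup using (interchange)
open import Data.Bool using (Bool; true; false; if_then_else_)
open import Data.Nat as ℕ using (ℕ; suc; _+_; _*_; _≤_; _∸_; _⊔_; _⊓_; z≤n; s≤s)
open import Data.Nat.Properties
open import Data.Nat.ListAction using (sum)
open import Data.List using ([]; _∷_; map; allFin; foldr)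
open import Data.List.Properties using (map-cong)
open import Data.List.Membership.Propositional using (_∈_)
open import Data.List.Relation.Unary.Any using (here; there)
open import Data.List.Relation.Unary.All using (All; []; _∷_; lookup; universal) renaming (map to All-map)
open import Data.List.Relation.Unary.AllPairs using ([]; _∷_)
open import Data.List.Relation.Unary.Unique.Propositional using (Unique)
open import Data.Product using (∃-syntax; _×_; _,_; proj₁; proj₂; uncurry)
open import Data.Sum using (_⊎_; inj₁; inj₂)
open import Function using (_∘_)
open import Relation.Nullary using (¬_; Dec; yes; no; contradiction)
open import Relation.Nullary.Decidable using (⌊_⌋)
open import Relation.Binary.PropositionalEquality
open import Relation.Binary.Construct.Closure.ReflexiveTransitive using (ε; _◅_)

module _ {A : Set} where

  sum-cong : ∀ {f g : A → ℕ} xs → f ≗ g → sum (map f xs) ≡ sum (map g xs)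
  sum-cong xs f≗g = cong sum (map-cong f≗g xs)

  sum-+ : ∀ (f g : A → ℕ) xs →
          sum (map (λ x → f x + g x) xs) ≡ sum (map f xs) + sum (map g xs)
  sum-+ f g []       = refl
  sum-+ f g (x ∷ xs) = trans (cong (f x + g x +_) (sum-+ f g xs))
                             (interchange +-commutativeSemigroup (f x) (g x) _ _)

  sum-*ˡ : ∀ (f : A → ℕ) k xs → k * sum (map f xs) ≡ sum (map (λ x → k * f x) xs)
  sum-*ˡ f k []       = *-zeroʳ k
  sum-*ˡ f k (x ∷ xs) = trans (*-distribˡ-+ k (f x) _) (cong (k * f x +_) (sum-*ˡ f k xs))

  sum-*ʳ : ∀ (f : A → ℕ) k xs → sum (map f xs) * k ≡ sum (map (λ x → f x * k) xs)
  sum-*ʳ f k []       = refl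
  sum-*ʳ f k (x ∷ xs) = trans (*-distribʳ-+ k (f x) _) (cong (f x * k +_) (sum-*ʳ f k xs))

  sum-mono-≤ : ∀ {f g : A → ℕ} xs → (∀ x → f x ≤ g x) → sum (map f xs) ≤ sum (map g xs)
  sum-mono-≤ []       f≤g = z≤n
  sum-mono-≤ (x ∷ xs) f≤g = +-mono-≤ (f≤g x) (sum-mono-≤ xs f≤g)

  sum-zero : ∀ {f : A → ℕ} {xs} → All (λ x → f x ≡ 0) xs → sum (map f xs) ≡ 0
  sum-zero []           = refl
  sum-zero (fx≡0 ∷ f≡0) = cong₂ _+_ fx≡0 (sum-zero f≡0)

  sum≡0⇒∈⇒≡0 : ∀ {f : A → ℕ} xs → sum (map f xs) ≡ 0 → ∀ {x} → x ∈ xs → f x ≡ 0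
  sum≡0⇒∈⇒≡0 {f} (y ∷ xs) eq (here refl) = m+n≡0⇒m≡0 (f y) eq
  sum≡0⇒∈⇒≡0 {f} (y ∷ xs) eq (there x∈xs) = sum≡0⇒∈⇒≡0 xs (m+n≡0⇒n≡0 (f y) eq) x∈xs

  sum≢0⇒∃≢0 : ∀ {f : A → ℕ} xs → sum (map f xs) ≢ 0 → ∃[ x ] f x ≢ 0
  sum≢0⇒∃≢0 []           ne = contradiction refl ne
  sum≢0⇒∃≢0 {f} (x ∷ xs) ne with f x ℕ.≟ 0
  ... | no  fx≢0 = x , fx≢0
  ... | yes fx≡0 = sum≢0⇒∃≢0 xs (ne ∘ cong₂ _+_ fx≡0)

sum-swap : ∀ {A B : Set} (f : A → B → ℕ) xs ys →
           sum (map (λ x → sum (map (f x) ys)) xs) ≡ sum (map (λ y → sum (map (λ x → f x y) xs)) ys)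
sum-swap f []       ys = sym (sum-zero (universal (λ _ → refl) ys))
sum-swap f (x ∷ xs) ys = trans (cong (sum (map (f x) ys) +_) (sum-swap f xs ys))
                               (sym (sum-+ (f x) _ ys))

≤-foldr-⊔ : ∀ z xs → z ≤ foldr _⊔_ z xs
≤-foldr-⊔ z []       = ≤-refl
≤-foldr-⊔ z (x ∷ xs) = m≤n⇒m≤o⊔n x (≤-foldr-⊔ z xs)

module ProtocolFacts (𝒫 : Protocol) where
  open Protocol 𝒫
  open Semantics 𝒫

  total : Config → (Q → ℕ) → ℕ
  total C w = sumQ λ r → C r * w r

  record _enables_ (C : Config) (t : Tr) : Set where
    constructor enabled
    field pre≤ : ∀ r → pre t r ≤ C r

  Silent : Tr → Set
  Silent t = ∀ r → pre t r ≡ post t r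

  ind-refl : ∀ p → ind p p ≡ 1
  ind-refl p with p ≟Q p
  ... | yes _   = refl
  ... | no p≢p = contradiction refl p≢p

  ind-≢ : ∀ {p r} → p ≢ r → ind p r ≡ 0
  ind-≢ {p} {r} p≢r with p ≟Q r
  ... | yes p≡r = contradiction p≡r p≢r
  ... | no _    = refl

  ind≡suc⇒≡ : ∀ {p r n} → ind p r ≡ suc n → p ≡ r
  ind≡suc⇒≡ {p} {r} eq with p ≟Q r
  ... | yes p≡r = p≡r

  sumQ-ind : ∀ p (w : Q → ℕ) → sumQ (λ r → ind p r * w r) ≡ w p
  sumQ-ind p w = go Qs Qs-unique (Qs-complete p)
    where
    go : ∀ xs → Unique xs → p ∈ xs → sum (map (λ r → ind p r * w r) xs) ≡ w p
    go (x ∷ xs) (p∉xs ∷ _) (here refl) =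
      trans (cong₂ _+_ (cong (_* w p) (ind-refl p))
                       (sum-zero (All-map (λ p≢y → cong (_* w _) (ind-≢ p≢y)) p∉xs)))
            (trans (+-identityʳ _) (*-identityˡ _))
    go (x ∷ xs) (x∉xs ∷ u) (there p∈xs) =
      trans (cong (λ n → n * w x + _) (ind-≢ λ p≡x → lookup x∉xs p∈xs (sym p≡x))) (go xs u p∈xs)

  total-cong : ∀ {C D : Config} (w : Q → ℕ) → C ≗ D → total C w ≡ total D w
  total-cong w C≗D = sum-cong Qs λ r → cong (_* w r) (C≗D r)

  total-+ : ∀ (C D : Config) (w : Q → ℕ) → total (λ r → C r + D r) w ≡ total C w + total D w
  total-+ C D w = trans (sum-cong Qs λ r → *-distribʳ-+ (w r) (C r) (D r)) (sum-+ _ _ Qs)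

  total-pre : ∀ p q p' q' (w : Q → ℕ) → total (pre (p , q , p' , q')) w ≡ w p + w q
  total-pre p q p' q' w =
    trans (total-+ (ind p) (ind q) w) (cong₂ _+_ (sumQ-ind p w) (sumQ-ind q w))

  total-post : ∀ p q p' q' (w : Q → ℕ) → total (post (p , q , p' , q')) w ≡ w p' + w q'
  total-post p q p' q' = total-pre p' q' p q

  constant-conserved : ∀ t n → total (pre t) (λ _ → n) ≡ total (post t) (λ _ → n)
  constant-conserved (p , q , p' , q') n =
    trans (total-pre p q p' q' (λ _ → n)) (sym (total-post p q p' q' (λ _ → n)))

  sumTr-cong : ∀ {F G : Tr → ℕ} → F ≗ G → sumTr F ≡ sumTr G
  sumTr-cong F≗G =
    sum-cong Qs λ p → sum-cong Qs λ q → sum-cong Qs λ p' → sum-cong Qs λ q' → F≗G (p , q , p' , q')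

  sumTr-*ʳ : ∀ (F : Tr → ℕ) k → sumTr F * k ≡ sumTr (λ t → F t * k)
  sumTr-*ʳ F k =
    trans (sum-*ʳ _ k Qs) (sum-cong Qs λ p →
    trans (sum-*ʳ _ k Qs) (sum-cong Qs λ q →
    trans (sum-*ʳ _ k Qs) (sum-cong Qs λ p' →
    sum-*ʳ _ k Qs)))

  sumQ-sumTr : ∀ (H : Tr → Q → ℕ) → sumQ (λ r → sumTr (λ t → H t r)) ≡ sumTr (λ t → sumQ (H t))
  sumQ-sumTr H =
    trans (sum-swap _ Qs Qs) (sum-cong Qs λ p →
    trans (sum-swap _ Qs Qs) (sum-cong Qs λ q →
    trans (sum-swap _ Qs Qs) (sum-cong Qs λ p' →
    sum-swap _ Qs Qs)))

  total-sumTr : ∀ (x : Tr → ℕ) (D : Tr → Config) (w : Q → ℕ) →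
                total (λ r → sumTr λ t → x t * D t r) w ≡ sumTr (λ t → x t * total (D t) w)
  total-sumTr x D w = begin
    sumQ (λ r → sumTr (λ t → x t * D t r) * w r)  ≡⟨ sum-cong Qs (λ r → sumTr-*ʳ _ (w r)) ⟩
    sumQ (λ r → sumTr (λ t → x t * D t r * w r))  ≡⟨ sumQ-sumTr _ ⟩
    sumTr (λ t → sumQ (λ r → x t * D t r * w r))  ≡⟨ sumTr-cong (λ t → sum-cong Qs λ r → *-assoc (x t) _ _) ⟩
    sumTr (λ t → sumQ (λ r → x t * (D t r * w r))) ≡⟨ sumTr-cong (λ t → sym (sum-*ˡ _ (x t) Qs)) ⟩
    sumTr (λ t → x t * total (D t) w)              ∎
    where open ≡-Reasoning

  consumed produced : (Tr → ℕ) → Config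
  consumed x r = sumTr λ t → x t * pre t r
  produced x r = sumTr λ t → x t * post t r

  supp-cong : ∀ {x : Tr → ℕ} {F G : Tr → ℕ} → (∀ t → InSupp x t → F t ≡ G t) →
              ∀ t → x t * F t ≡ x t * G t
  supp-cong {x} F≡G t with x t ℕ.≟ 0
  ... | yes xt≡0 rewrite xt≡0 = refl
  ... | no  xt≢0 = cong (x t *_) (F≡G t xt≢0)

  flow-preserves-total : ∀ {C C' x} (w : Q → ℕ) → Flow C C' x →
    (∀ t → InSupp x t → total (pre t) w ≡ total (post t) w) → total C' w ≡ total C w
  flow-preserves-total {C} {C'} {x} w flow conserved = +-cancelʳ-≡ _ _ _ (begin
    total C' w + total (consumed x) w    ≡⟨ total-+ C' (consumed x) w ⟨
    total (λ r → C' r + consumed x r) w  ≡⟨ total-cong w flow ⟩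
    total (λ r → C r + produced x r) w   ≡⟨ total-+ C (produced x) w ⟩
    total C w + total (produced x) w     ≡⟨ cong (total C w +_) produced≡consumed ⟩
    total C w + total (consumed x) w     ∎)
    where
    open ≡-Reasoning
    produced≡consumed : total (produced x) w ≡ total (consumed x) w
    produced≡consumed = begin
      total (produced x) w              ≡⟨ total-sumTr x post w ⟩
      sumTr (λ t → x t * total (post t) w) ≡⟨ sumTr-cong (supp-cong λ t t∈U → sym (conserved t t∈U)) ⟩
      sumTr (λ t → x t * total (pre t) w)  ≡⟨ total-sumTr x pre w ⟨
      total (consumed x) w              ∎

  flow-silent-unchanged : ∀ {C C' x} → Flow C C' x → (∀ t → InSupp x t → Silent t) → C' ≗ C
  flow-silent-unchanged {C} {x = x} flow silent r = +-cancelʳ-≡ _ _ _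
    (trans (flow r) (cong (C r +_) (sumTr-cong (supp-cong λ t t∈U → sym (silent t t∈U r)))))

  unmarked-trap-unchanged : ∀ {C C'} (P : Subset) →
    (∀ t → T t → (P •) t → (• P) t) → (∀ t → T t → ¬ (• P) t → Silent t) →
    PotentiallyReachable C C' → mass C' P ≡ 0 → C' ≗ C
  unmarked-trap-unchanged P trap unfed-silent (x , x⊆T , flow , trap-condition , _) unmarked =
    flow-silent-unchanged flow λ t t∈U →
      unfed-silent t (x⊆T t t∈U) (trap-condition P (λ t t∈U → trap t (x⊆T t t∈U)) unmarked t t∈U)

  terminal-enabled-silent : ∀ {C t} → Terminal C → T t → C enables t → Silent t
  terminal-enabled-silent {C} {t} terminal t∈T (enabled pre≤) r = +-cancelˡ-≡ (C r) _ _ (begin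
    C r + pre t r  ≡⟨ cong (_+ pre t r) (unchanged r) ⟨
    C' r + pre t r ≡⟨ step-eq r ⟩
    C r + post t r ∎)
    where
    open ≡-Reasoning
    C' : Config
    C' r = C r + post t r ∸ pre t r
    step-eq : ∀ r → C' r + pre t r ≡ C r + post t r
    step-eq r = m∸n+n≡m (≤-trans (pre≤ r) (m≤m+n (C r) (post t r)))
    unchanged : C' ≗ C
    unchanged = terminal C' ((t , t∈T , pre≤ , step-eq) ◅ ε)

  silent-pair : ∀ {p q p' q'} → Silent (p , q , p' , q') → (p ≡ p' × q ≡ q') ⊎ (p ≡ q' × q ≡ p')
  silent-pair {p} {q} {p'} {q'} silent with p ≟Q p'
  ... | yes refl = inj₁ (refl , ind≡suc⇒≡ (trans (same-q q') (ind-refl q')))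
    where
    same-q : ∀ r → ind q r ≡ ind q' r
    same-q r = +-cancelˡ-≡ (ind p r) _ _ (silent r)
  ... | no p≢p' = inj₂ (ind≡suc⇒≡ (trans (same-p q') (ind-refl q')) , q≡p')
    where
    open ≡-Reasoning
    q≡p' : q ≡ p'
    q≡p' = ind≡suc⇒≡ (begin
      ind q p'                ≡⟨ cong (_+ ind q p') (ind-≢ p≢p') ⟨
      ind p p' + ind q p'     ≡⟨ silent p' ⟩
      ind p' p' + ind q' p'   ≡⟨ cong (_+ ind q' p') (ind-refl p') ⟩
      suc (ind q' p')         ∎)
    same-p : ∀ r → ind p r ≡ ind q' r
    same-p r = +-cancelˡ-≡ (ind p' r) _ _ (begin
      ind p' r + ind p r ≡⟨ +-comm (ind p' r) (ind p r) ⟩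
      ind p r + ind p' r ≡⟨ cong (λ s → ind p r + ind s r) q≡p' ⟨
      ind p r + ind q r  ≡⟨ silent r ⟩
      ind p' r + ind q' r ∎)

  distinct-occupied-enable : ∀ {C p q p' q'} → p ≢ q → C p ≢ 0 → C q ≢ 0 → C enables (p , q , p' , q')
  distinct-occupied-enable {C} {p} {q} p≢q Cp≢0 Cq≢0 = enabled pre≤
    where
    pre≤ : ∀ r → ind p r + ind q r ≤ C r
    pre≤ r with p ≟Q r | q ≟Q r
    ... | yes refl | yes refl = contradiction refl p≢q
    ... | yes refl | no _     = n≢0⇒n>0 Cp≢0
    ... | no _     | yes refl = n≢0⇒n>0 Cq≢0
    ... | no _     | no _     = z≤n

  twice-occupied-enables : ∀ {C p p' q'} → 2 ≤ C p → C enables (p , p , p' , q')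
  twice-occupied-enables {C} {p} 2≤Cp = enabled pre≤
    where
    pre≤ : ∀ r → ind p r + ind p r ≤ C r
    pre≤ r with p ≟Q r
    ... | yes refl = 2≤Cp
    ... | no _     = z≤n

  mass≡0⇒unoccupied : ∀ {C P r} → mass C P ≡ 0 → P r ≡ true → C r ≡ 0
  mass≡0⇒unoccupied {C} {P} {r} unmarked Pr with sum≡0⇒∈⇒≡0 Qs unmarked (Qs-complete r)
  ... | Cr≡0 rewrite Pr = Cr≡0

  mass≢0⇒occupied : ∀ {C P} → mass C P ≢ 0 → ∃[ r ] P r ≡ true × C r ≢ 0
  mass≢0⇒occupied {C} {P} marked with sum≢0⇒∃≢0 Qs marked
  ... | r , Cr≢0 with P r in Pr
  ...   | true  = r , Pr , Cr≢0
  ...   | false = contradiction refl Cr≢0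

  population-occupied : ∀ {C} → IsPopulation C → ∃[ r ] C r ≢ 0
  population-occupied population = sum≢0⇒∃≢0 Qs λ size≡0 → contradiction (subst (2 ≤_) size≡0 population) λ ()

  another-occupied : ∀ {C p} → IsPopulation C → C p ≤ 1 → ∃[ q ] p ≢ q × C q ≢ 0
  another-occupied {C} {p} population Cp≤1 = other-witness (sum≢0⇒∃≢0 Qs others≢0)
    where
    others : Config
    others r = if ⌊ p ≟Q r ⌋ then 0 else C r
    split : ∀ r → C r ≡ ind p r * C r + others r
    split r with p ≟Q r
    ... | yes _ = sym (trans (+-identityʳ _) (*-identityˡ _))
    ... | no _  = refl
    others≢0 : sumQ others ≢ 0
    others≢0 others≡0 = contradiction (≤-trans population (≤-trans (≤-reflexive size) Cp≤1)) λ { (s≤s ()) }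
      where
      size : sumQ C ≡ C p
      size = trans (sum-cong Qs split)
                   (trans (sum-+ _ _ Qs) (trans (cong₂ _+_ (sumQ-ind p C) others≡0) (+-identityʳ _)))
    other-witness : ∃[ q ] others q ≢ 0 → ∃[ q ] p ≢ q × C q ≢ 0
    other-witness (q , q-other) with p ≟Q q
    ... | yes _  = contradiction refl q-other
    ... | no p≢q = q , p≢q , q-other

  initial-outside-image : ∀ X {r} → (∀ σ → I σ ≢ r) → initial X r ≡ 0
  initial-outside-image X {r} I≢r = sum-zero (universal term≡0 (allFin nΣ))
    where
    term≡0 : ∀ σ → (if ⌊ I σ ≟Q r ⌋ then X σ else 0) ≡ 0
    term≡0 σ with I σ ≟Q r
    ... | yes Iσ≡r = contradiction Iσ≡r (I≢r σ)
    ... | no _     = refl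

  total-≤-except : ∀ C (w w' : Q → ℕ) p → (∀ r → p ≢ r → C r ≢ 0 → w r ≤ w' r) →
                   total C w + C p * w' p ≤ C p * w p + total C w'
  total-≤-except C w w' p w≤w' = begin
    total C w + C p * w' p                                ≡⟨ cong (total C w +_) (sumQ-ind p (λ r → C r * w' r)) ⟨
    total C w + sumQ (λ r → ind p r * (C r * w' r))       ≡⟨ sum-+ _ _ Qs ⟨
    sumQ (λ r → C r * w r + ind p r * (C r * w' r))       ≤⟨ sum-mono-≤ Qs pointwise ⟩
    sumQ (λ r → ind p r * (C r * w r) + C r * w' r)       ≡⟨ sum-+ _ _ Qs ⟩
    sumQ (λ r → ind p r * (C r * w r)) + total C w'       ≡⟨ cong (_+ total C w') (sumQ-ind p (λ r → C r * w r)) ⟩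
    C p * w p + total C w'                                ∎
    where
    open ≤-Reasoning
    pointwise : ∀ r → C r * w r + ind p r * (C r * w' r) ≤ ind p r * (C r * w r) + C r * w' r
    pointwise r with p ≟Q r
    ... | yes refl = ≤-reflexive (cong₂ _+_ (sym (*-identityˡ (C p * w p))) (*-identityˡ (C p * w' p)))
    ... | no p≢r with C r ℕ.≟ 0
    ...   | yes Cr≡0 rewrite Cr≡0 = z≤n
    ...   | no Cr≢0 = ≤-trans (≤-reflexive (+-identityʳ _)) (*-monoʳ-≤ (C r) (w≤w' r p≢r Cr≢0))

module ThresholdFacts (k : ℕ) (a : Fin k → ℤ) (c : ℤ) where
  open Threshold k a c
  open Protocol Pthr using (_≟Q_; O)
  open Semantics Pthr
  open ProtocolFacts Pthr
  open IntegerFacts.Clamp vmax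

  c<V : c ℤ.< V
  c<V = ∣i∣<n⇒i<n c (≤-foldr-⊔ (suc ∣ c ∣) (map (λ i → ∣ a i ∣) (allFin k)))

  -V<c : ℤ.- V ℤ.< c
  -V<c = ∣i∣<n⇒-n<i c (≤-foldr-⊔ (suc ∣ c ∣) (map (λ i → ∣ a i ∣) (allFin k)))

  val-bounds : ∀ n → ℤ.- V ℤ.≤ val n × val n ℤ.≤ V
  val-bounds n =
      ℤP.≤-trans (ℤP.≤-reflexive (sym (ℤP.+-identityˡ (ℤ.- V)))) (ℤP.+-monoˡ-≤ (ℤ.- V) (ℤ.+≤+ z≤n))
    , ℤP.≤-trans (ℤP.+-monoˡ-≤ (ℤ.- V) (ℤ.+≤+ (toℕ≤pred[n] n))) (ℤP.≤-reflexive (cancel V V))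
    where
    cancel : ∀ x y → x ℤ.+ y ℤ.- y ≡ x
    cancel = solve-∀

  val-enc : ∀ z → ℤ.- V ℤ.≤ z → z ℤ.≤ V → val (enc z) ≡ z
  val-enc z lower upper = begin
    val (enc z)                              ≡⟨ cong (λ i → ℤ.+ i ℤ.- V) (toℕ-fromℕ< _) ⟩
    ℤ.+ (∣ z ℤ.+ V ∣ ⊓ (vmax + vmax)) ℤ.- V  ≡⟨ cong (λ i → ℤ.+ i ℤ.- V) (m≤n⇒m⊓n≡m ∣z+V∣≤) ⟩
    ℤ.+ ∣ z ℤ.+ V ∣ ℤ.- V                    ≡⟨ cong (ℤ._- V) +∣z+V∣≡z+V ⟩
    z ℤ.+ V ℤ.- V                            ≡⟨ cancel z V ⟩
    z                                        ∎
    where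
    open ≡-Reasoning
    cancel : ∀ x y → x ℤ.+ y ℤ.- y ≡ x
    cancel = solve-∀
    +∣z+V∣≡z+V : ℤ.+ ∣ z ℤ.+ V ∣ ≡ z ℤ.+ V
    +∣z+V∣≡z+V = ℤP.0≤i⇒+∣i∣≡i (subst (ℤ._≤ z ℤ.+ V) (ℤP.+-inverseˡ V) (ℤP.+-monoˡ-≤ V lower))
    ∣z+V∣≤ : ∣ z ℤ.+ V ∣ ≤ vmax + vmax
    ∣z+V∣≤ = ℤP.drop‿+≤+ (subst (ℤ._≤ V ℤ.+ V) (sym +∣z+V∣≡z+V) (ℤP.+-monoˡ-≤ V upper))

  isActive : Subset
  isActive (ℓ , _ , _) = ℓ

  level : State → ℕ
  level (_ , n , _) = toℕ n

  meet : Val → Bool → State → Tr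
  meet n o r@(_ , n' , _) =
    (true , n , o) , r , (true , enc (f m m') , bb m m') , (false , enc (g m m') , bb m m')
    where
    m m' : ℤ
    m  = val n
    m' = val n'

  meet-∈T : ∀ n o r → Trans (meet n o r)
  meet-∈T n o (_ , n' , _) =
    inj₁ (refl , refl , val-enc _ (-V≤clamp z) (clamp≤V z) , refl ,
          refl , uncurry (val-enc _) (excess-bounds z lower upper) , refl)
    where
    z : ℤ
    z = val n ℤ.+ val n'
    lower : ℤ.- V ℤ.+ ℤ.- V ℤ.≤ z
    lower = ℤP.+-mono-≤ (proj₁ (val-bounds n)) (proj₁ (val-bounds n'))
    upper : z ℤ.≤ V ℤ.+ V
    upper = ℤP.+-mono-≤ (proj₂ (val-bounds n)) (proj₂ (val-bounds n'))

  active-trap : ∀ t → Trans t → (isActive •) t → (• isActive) t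
  active-trap _ (inj₁ (_ , ℓ₃≡true , _)) _ = inj₁ ℓ₃≡true
  active-trap ((_ , _) , (_ , _) , _ , _) (inj₂ (refl , refl , _)) (inj₁ ())
  active-trap ((_ , _) , (_ , _) , _ , _) (inj₂ (refl , refl , _)) (inj₂ ())

  unfed-silent : ∀ t → Trans t → ¬ (• isActive) t → Silent t
  unfed-silent _ (inj₁ (_ , ℓ₃≡true , _)) unfed = contradiction (inj₁ ℓ₃≡true) unfed
  unfed-silent _ (inj₂ (_ , _ , refl , refl)) _ r = refl

  val-+-injective : ∀ {n₁ n₂ n₃ n₄} → val n₁ ℤ.+ val n₂ ≡ val n₃ ℤ.+ val n₄ →
                    toℕ n₁ + toℕ n₂ ≡ toℕ n₃ + toℕ n₄
  val-+-injective {n₁} {n₂} {n₃} {n₄} eq = ℤP.+-injective (begin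
    ℤ.+ toℕ n₁ ℤ.+ ℤ.+ toℕ n₂             ≡⟨ unshift (ℤ.+ toℕ n₁) (ℤ.+ toℕ n₂) V ⟩
    val n₁ ℤ.+ val n₂ ℤ.+ (V ℤ.+ V)       ≡⟨ cong (ℤ._+ (V ℤ.+ V)) eq ⟩
    val n₃ ℤ.+ val n₄ ℤ.+ (V ℤ.+ V)       ≡⟨ unshift (ℤ.+ toℕ n₃) (ℤ.+ toℕ n₄) V ⟨
    ℤ.+ toℕ n₃ ℤ.+ ℤ.+ toℕ n₄             ∎)
    where
    open ≡-Reasoning
    unshift : ∀ x y z → x ℤ.+ y ≡ x ℤ.- z ℤ.+ (y ℤ.- z) ℤ.+ (z ℤ.+ z)
    unshift = solve-∀

  level-conserved : ∀ t → Trans t → total (pre t) level ≡ total (post t) level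
  level-conserved (p@(_ , n₁ , _) , q@(_ , n₂ , _) , p'@(_ , n₃ , _) , q'@(_ , n₄ , _))
                  (inj₁ (_ , _ , n₃≡f , _ , _ , n₄≡g , _)) = begin
    total (pre (p , q , p' , q')) level   ≡⟨ total-pre p q p' q' level ⟩
    toℕ n₁ + toℕ n₂                       ≡⟨ val-+-injective (sym (trans (cong₂ ℤ._+_ n₃≡f n₄≡g) (clamp+excess z))) ⟩
    toℕ n₃ + toℕ n₄                       ≡⟨ total-post p q p' q' level ⟨
    total (post (p , q , p' , q')) level  ∎
    where
    open ≡-Reasoning
    z : ℤ
    z = val n₁ ℤ.+ val n₂
  level-conserved _ (inj₂ (_ , _ , refl , refl)) = refl

  -- Σ_r C(r)·val(r), computed from the shifted values toℕ n = val n + vmax so that the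
  -- flow equations over ℕ apply to both sums.
  value : Config → ℤ
  value C = ℤ.+ total C level ℤ.- ℤ.+ total C (λ _ → vmax)

  value-invariant : ∀ {C C'} → PotentiallyReachable C C' → value C' ≡ value C
  value-invariant {C} {C'} (x , x⊆T , flow , _) = cong₂ (λ L N → ℤ.+ L ℤ.- ℤ.+ N)
    (flow-preserves-total {C} {C'} {x} level flow λ t t∈U → level-conserved t (x⊆T t t∈U))
    (flow-preserves-total {C} {C'} {x} (λ _ → vmax) flow λ t _ → constant-conserved t vmax)

  -- The initial value is Σ aᵢXᵢ, but only its invariance is used.
  decision : (Fin k → ℕ) → Bool
  decision X = ⌊ value (initial X) ℤ.<? c ⌋

  module _ {C : Config} {n : Val} {o : Bool} (alone : C (true , n , o) ≡ 1) where

    private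
      alone-* : ∀ w → C (true , n , o) * w ≡ w
      alone-* w = trans (cong (_* w) alone) (*-identityˡ w)

    value≤leader : (∀ r → (true , n , o) ≢ r → C r ≢ 0 → level r ≤ vmax) → value C ℤ.≤ val n
    value≤leader followers≤ =
      m+n≤o+p⇒m-p≤o-n (total C level) vmax (toℕ n) (total C (λ _ → vmax)) bound
      where
      bound : total C level + vmax ≤ toℕ n + total C (λ _ → vmax)
      bound = subst₂ _≤_
        (cong (total C level +_) (alone-* vmax)) (cong (_+ total C (λ _ → vmax)) (alone-* (toℕ n)))
        (total-≤-except C level (λ _ → vmax) (true , n , o) followers≤)

    leader≤value : (∀ r → (true , n , o) ≢ r → C r ≢ 0 → vmax ≤ level r) → val n ℤ.≤ value C
    leader≤value followers≥ =
      m+n≤o+p⇒m-p≤o-n (toℕ n) (total C (λ _ → vmax)) (total C level) vmax bound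
      where
      bound : toℕ n + total C (λ _ → vmax) ≤ total C level + vmax
      bound = subst₂ _≤_
        (trans (cong (total C (λ _ → vmax) +_) (alone-* (toℕ n))) (+-comm _ (toℕ n)))
        (trans (cong (_+ total C level) (alone-* vmax)) (+-comm vmax _))
        (total-≤-except C (λ _ → vmax) level (true , n , o) followers≥)

  Settled : ℤ → State → Set
  Settled m (ℓ' , n' , o') = f m (val n') ≡ m × ℓ' ≡ false × o' ≡ ⌊ m ℤ.<? c ⌋

  module _ {C : Config} (terminal : Terminal C) where

    -- A terminal C makes the meeting silent, so {leader, r} equals the multiset of its two
    -- outputs, and the leader cannot be the passive one.
    meet-settled : ∀ {n o r} → C enables meet n o r → o ≡ ⌊ val n ℤ.<? c ⌋ × Settled (val n) r
    meet-settled {n} {o} {r@(ℓ' , n' , o')} can-meet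
      with silent-pair (terminal-enabled-silent terminal (meet-∈T n o r) can-meet)
    ... | inj₂ (leader-demoted , _) = contradiction (cong proj₁ leader-demoted) λ ()
    ... | inj₁ (leader-stays , partner-demoted) =
      trans (cong (proj₂ ∘ proj₂) leader-stays) decides-m ,
      fixed , cong proj₁ partner-demoted , trans (cong (proj₂ ∘ proj₂) partner-demoted) decides-m
      where
      fixed : f (val n) (val n') ≡ val n
      fixed = sym (trans (cong (val ∘ proj₁ ∘ proj₂) leader-stays)
                         (val-enc _ (-V≤clamp _) (clamp≤V _)))
      decides-m : bb (val n) (val n') ≡ ⌊ val n ℤ.<? c ⌋
      decides-m = cong (λ m → ⌊ m ℤ.<? c ⌋) fixed

    leader-alone : ∀ {n o} → C (true , n , o) ≢ 0 → C (true , n , o) ≡ 1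
    leader-alone {n} {o} occupied with 2 ≤? C (true , n , o)
    ... | yes twice = contradiction (proj₁ (proj₂ (proj₂ (meet-settled (twice-occupied-enables twice))))) λ ()
    ... | no ¬twice = ≤-antisym (≤-pred (≰⇒> ¬twice)) (n≢0⇒n>0 occupied)

  active-occupied : ∀ {X C} → IsPopulation C → PotentiallyReachable (initial X) C →
                    ∃[ n ] ∃[ o ] C (true , n , o) ≢ 0
  active-occupied {X} {C} population reach = from-mass (mass C isActive ℕ.≟ 0)
    where
    active : ∃[ r ] isActive r ≡ true × C r ≢ 0 → ∃[ n ] ∃[ o ] C (true , n , o) ≢ 0
    active ((true  , n , o) , _  , occupied) = n , o , occupied
    active ((false , _ , _) , () , _)
    from-mass : Dec (mass C isActive ≡ 0) → ∃[ n ] ∃[ o ] C (true , n , o) ≢ 0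
    from-mass (no marked) = active (mass≢0⇒occupied {C} {isActive} marked)
    from-mass (yes unmarked) = contradiction (population-occupied population) empty
      where
      unchanged : C ≗ initial X
      unchanged = unmarked-trap-unchanged {initial X} {C} isActive active-trap unfed-silent reach unmarked
      empty : ¬ (∃[ r ] C r ≢ 0)
      empty ((true  , n , o) , occupied) = occupied (mass≡0⇒unoccupied {C} {isActive} unmarked refl)
      empty ((false , n , o) , occupied) =
        occupied (trans (unchanged _) (initial-outside-image X {false , n , o} λ _ active≡passive →
                                         contradiction (cong proj₁ active≡passive) λ ()))

  leader-decides : ∀ {C n o} → C (true , n , o) ≡ 1 →
    (∀ r → (true , n , o) ≢ r → C r ≢ 0 → Settled (val n) r) →
    ⌊ val n ℤ.<? c ⌋ ≡ ⌊ value C ℤ.<? c ⌋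
  leader-decides {C} {n} {o} alone settled with val n ℤ.<? c | value C ℤ.<? c
  ... | yes _   | yes _   = refl
  ... | no _    | no _    = refl
  ... | yes m<c | no v≮c  = contradiction (ℤP.≤-<-trans (value≤leader alone followers≤) m<c) v≮c
    where
    followers≤ : ∀ r → (true , n , o) ≢ r → C r ≢ 0 → level r ≤ vmax
    followers≤ (_ , n' , _) ≢leader occupied = ℤP.drop‿+≤+ (ℤP.i-j≤0⇒i≤j
      (clamp-fixed⇒≤0 (val n) (val n') (proj₁ (settled _ ≢leader occupied)) (ℤP.<-trans m<c c<V)))
  ... | no m≮c  | yes v<c = contradiction (ℤP.≤-trans (ℤP.≮⇒≥ m≮c) (leader≤value alone followers≥)) (ℤP.<⇒≱ v<c)
    where
    followers≥ : ∀ r → (true , n , o) ≢ r → C r ≢ 0 → vmax ≤ level r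
    followers≥ (_ , n' , _) ≢leader occupied = ℤP.drop‿+≤+ (ℤP.0≤i-j⇒j≤i
      (clamp-fixed⇒≥0 (val n) (val n') (proj₁ (settled _ ≢leader occupied)) (ℤP.<-≤-trans -V<c (ℤP.≮⇒≥ m≮c))))

  terminal-consensus : ∀ {X C} → IsPopulation C → PotentiallyReachable (initial X) C → Terminal C →
                       ConsensusWith C (decision X)
  terminal-consensus {X} {C} population reach terminal with active-occupied population reach
  ... | n , o , occupied = subst (ConsensusWith C) decided consensus
    where
    leader : State
    leader = true , n , o
    meets : ∀ {r} → leader ≢ r → C r ≢ 0 → o ≡ ⌊ val n ℤ.<? c ⌋ × Settled (val n) r
    meets {r} ≢leader occupied′ =
      meet-settled terminal {r = r} (distinct-occupied-enable ≢leader occupied occupied′)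
    alone : C leader ≡ 1
    alone = leader-alone terminal occupied
    leader-output : o ≡ ⌊ val n ℤ.<? c ⌋
    leader-output =
      let _ , ≢leader , occupied′ = another-occupied {C} {leader} population (≤-reflexive alone)
      in proj₁ (meets ≢leader occupied′)
    consensus : ConsensusWith C ⌊ val n ℤ.<? c ⌋
    consensus r = agrees (leader ≟Q r)
      where
      agrees : ∀ {r} → Dec (leader ≡ r) → C r ≢ 0 → O r ≡ ⌊ val n ℤ.<? c ⌋
      agrees (yes refl) _ = leader-output
      agrees {_ , _ , _} (no ≢leader) occupied′ = proj₂ (proj₂ (proj₂ (meets ≢leader occupied′)))
    decided : ⌊ val n ℤ.<? c ⌋ ≡ decision X
    decided = trans (leader-decides alone (λ _ ≢leader occupied′ → proj₂ (meets ≢leader occupied′)))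
                    (cong (λ v → ⌊ v ℤ.<? c ⌋) (value-invariant reach))

proposition5 : (k : ℕ) → 1 ≤ k → (a : Fin k → ℤ) → (c : ℤ) →
    Semantics.StrongConsensus (Threshold.Pthr k a c)
proposition5 k _ a c X _ =
  decision X , λ C population reach terminal → terminal-consensus population reach terminal
  where open ThresholdFacts k a c
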